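{- Let $b\ge2$ and $N\ge1$ be integers and let $A=(a_0,\ldots,a_{b-1})$ be a zero-sum vector. Let $c_0,\dots,c_{b^N-1}$ be complex numbers, $\mathbf{c}_N=(c_0,\dots,c_{b^N-1})^T$ and $P_N(x;C_N)=\sum_{n=0}^{b^N-1}c_nx^n$. Then the polynomial equation \[ F_N(x;A)=P_N(x;C_N)\prod_{m=0}^{N-1}\bigl(1-x^{b^m}\bigr) \] holds if and only if the matrix equation $\mathbf{a}_N=M_N\mathbf{c}_N$ holds together with the condition $c_n=0$ for every $n$, $0\le n\le b^N-1$, whose base-$b$ expansion contains the digit $b-1$.
   Context: A zero-sum vector is a tuple $(a_0,\dots,a_{b-1})$ of complex numbers with $a_0+\cdots+a_{b-1}=0$. For a non-negative integer $n$ with base-$b$ digits $n_0,\dots,n_d$, $u_b(n)=\sum_j n_j \bmod b\in\{0,\dots,b-1\}$ (the generalized Prouhet-Thue-Morse sequence). $F_N(x;A)=\sum_{n=0}^{b^N-1}a_{u_b(n)}x^n$ and $\mathbf{a}_N=(a_{u_b(0)},a_{u_b(1)},\dots,a_{u_b(b^N-1)})^T$. $M_1$ is the $b\times b$ lower-bidiagonal matrix with all diagonal entries $1$, all entries directly below the diagonal equal to $-1$, and all other entries $0$; for $N\ge1$, $M_{N+1}=M_1\otimes M_N$ (Kronecker product), a $b^N\times b^N$ matrix. -}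

module Defs where

open import Level using (Level; _⊔_)
open import Data.Product using (∃)
open import Relation.Binary.PropositionalEquality using (_≡_)
open import Data.Nat using (ℕ; zero; suc; _∸_; _^_; _<_; _<?_; _≟_; NonZero)
open import Data.Nat.DivMod using (_/_; _%_; m%n<n)
open import Data.Nat.Properties using (m^n≢0)
open import Data.Fin using (Fin; fromℕ<)
import Data.Nat as ℕ
import Data.Fin as Fin
open import Relation.Nullary using (yes; no)
open import Algebra.Bundles using (CommutativeRing)

digit : (b : ℕ) .{{_ : NonZero b}} → ℕ → ℕ → ℕ
digit b j n = (_/_ n (b ^ j) {{m^n≢0 b j}}) % b

-- sum of base-b digits of n.  Digits with index ≥ n are 0 since b^n > n,
-- so summing digits 0..n covers the whole expansion.
digitSumUpTo : (b : ℕ) .{{_ : NonZero b}} → ℕ → ℕ → ℕ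
digitSumUpTo b zero    n = 0
digitSumUpTo b (suc k) n = digitSumUpTo b k n ℕ.+ digit b k n

digitSum : (b : ℕ) .{{_ : NonZero b}} → ℕ → ℕ
digitSum b n = digitSumUpTo b (suc n) n

u : (b : ℕ) .{{_ : NonZero b}} → ℕ → Fin b
u b n = fromℕ< (m%n<n (digitSum b n) b)

-- Definitions over a commutative ring (the paper uses ℂ)

module WithRing {c ℓ : Level} (R : CommutativeRing c ℓ) where
  open CommutativeRing R renaming (Carrier to C)

  sumTo : ℕ → (ℕ → C) → C
  sumTo zero    f = 0#
  sumTo (suc n) f = sumTo n f + f n

  sumFin : (n : ℕ) → (Fin n → C) → C
  sumFin zero    f = 0#
  sumFin (suc n) f = f Fin.zero + sumFin n (λ i → f (Fin.suc i))

  -- a polynomial is represented by its coefficient sequence ℕ → C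
  -- (all sequences used below have finite support)
  Poly : Set c
  Poly = ℕ → C

  _≈ₚ_ : Poly → Poly → Set ℓ
  p ≈ₚ q = ∀ n → p n ≈ q n

  _*ₚ_ : Poly → Poly → Poly
  (p *ₚ q) n = sumTo (suc n) (λ k → p k * q (n ∸ k))

  fromVec : (m : ℕ) → (Fin m → C) → Poly
  fromVec m v n with n <? m
  ... | yes n<m = v (fromℕ< n<m)
  ... | no  _   = 0#

  xPow : ℕ → Poly
  xPow k n with n ≟ k
  ... | yes _ = 1#
  ... | no  _ = 0#

  oneMinusXPow : ℕ → Poly
  oneMinusXPow k n = xPow 0 n - xPow k n

  prodQ : ℕ → ℕ → Poly
  prodQ b zero    = xPow 0
  prodQ b (suc m) = prodQ b m *ₚ oneMinusXPow (b ^ m)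

  F : (b : ℕ) .{{_ : NonZero b}} → ℕ → (Fin b → C) → Poly
  F b N a = fromVec (b ^ N) (λ n → a (u b (Fin.toℕ n)))

  P : (b N : ℕ) → (Fin (b ^ N) → C) → Poly
  P b N cs = fromVec (b ^ N) cs

  -- Matrices as entry functions on ℕ × ℕ (only indices < size are meaningful).
  Mat : Set c
  Mat = ℕ → ℕ → C

  M₁ : Mat
  M₁ i j with i ≟ j | i ≟ suc j
  ... | yes _ | _     = 1#
  ... | no  _ | yes _ = - 1#
  ... | no  _ | no  _ = 0#

  kron : (s : ℕ) .{{_ : NonZero s}} → Mat → Mat → Mat
  kron s A B i j = A (i / s) (j / s) * B (i % s) (j % s)

  -- M_N for N ≥ 1: M_1, and M_{N+1} = M_1 ⊗ M_N  (M_N is b^N × b^N).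
  -- (The value at N = 0 is never used by the theorem.)
  M : (b : ℕ) .{{_ : NonZero b}} → ℕ → Mat
  M b zero          = xPowMat
    where xPowMat : Mat
          xPowMat i j = xPow j i
  M b (suc zero)    = M₁
  M b (suc (suc N)) = kron (b ^ suc N) {{m^n≢0 b (suc N)}} M₁ (M b (suc N))

  matEq : (b : ℕ) .{{_ : NonZero b}} → (N : ℕ) → (Fin b → C) → (Fin (b ^ N) → C) → Set ℓ
  matEq b N a cs = ∀ (n : Fin (b ^ N)) →
    a (u b (Fin.toℕ n)) ≈ sumFin (b ^ N) (λ k → M b N (Fin.toℕ n) (Fin.toℕ k) * cs k)

  ZeroSum : (b : ℕ) → (Fin b → C) → Set ℓ
  ZeroSum b a = sumFin b a ≈ 0#

  digitCond : (b : ℕ) .{{_ : NonZero b}} → (N : ℕ) → (Fin (b ^ N) → C) → Set ℓ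
  digitCond b N cs = ∀ (n : Fin (b ^ N)) →
    (∃ λ j → digit b j (Fin.toℕ n) ≡ b ∸ 1) → cs n ≈ 0#

-- Write Q_N = ∏_{m<N} (1 - x^(b^m)) and cut coefficient sequences into blocks of
-- length b^N.  If c vanishes at every index having a digit b - 1 among its N lowest
-- digits, then on every block the coefficients of c Q_N are M_N applied to those of c:
-- by induction on N, the factor 1 - x^(b^N) subtracts the previous block, which is what
-- the Kronecker factor M_1 does, and the digit condition kills what would otherwise be
-- carried over from the last block of the previous group of b.  Conversely,
-- multiplication by Q_N is injective, so it suffices to exhibit one solution: iterated
-- partial sums c_n = Σ_{e ≤ n digitwise} a_{(e_0 + ⋯ + e_{N-1}) mod b} satisfy a_N = M_N c_N
-- because M_N undoes the N summations, and c_n = 0 when some digit of n is b - 1 because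
-- the summation over that digit runs through a full period of the zero-sum vector.

module Submission where

open import Level using (Level)
open import Function.Base using (_∘_)
open import Function.Bundles using (_⇔_; mk⇔)
open import Data.Empty using (⊥-elim)
open import Data.Sum using (inj₁; inj₂)
open import Data.Product using (_×_; _,_; uncurry)
open import Data.Nat
  using (ℕ; zero; suc; _+_; _*_; _∸_; _^_; _≤_; _<_; _≤?_; _<?_; _≟_; _≤′_; ≤′-refl; ≤′-step;
         NonZero; >-nonZero⁻¹; z≤n; s≤s)
import Data.Nat.Properties as ℕ
open import Data.Nat.DivMod
  using (_/_; _%_; m%n<n; m≡m%n+[m/n]*n; +-distrib-/-∣ˡ; m*n/n≡m; m<n⇒m/n≡0; [m+kn]%n≡m%n;
         m<n⇒m%n≡m; %-remove-+ˡ)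
open import Data.Nat.Divisibility using (_∣_; divides; n∣m*n; ∣-refl)
open import Data.Nat.Induction using (<-rec)
open import Data.Nat.Tactic.RingSolver using (solve-∀)
open import Data.Fin as Fin using (Fin; toℕ; fromℕ<)
open import Data.Fin.Properties using (toℕ<n; toℕ-fromℕ<; fromℕ<-toℕ; fromℕ<-cong)
open import Relation.Nullary using (yes; no)
import Relation.Binary.PropositionalEquality as ≡
open ≡ using (_≡_; _≢_)
open import Algebra.Bundles using (CommutativeRing)

open import Defs

[m*n+o]/n≡m+o/n : ∀ m n .{{_ : NonZero n}} o → (m * n + o) / n ≡ m + o / n
[m*n+o]/n≡m+o/n m n o = ≡.trans (+-distrib-/-∣ˡ o (n∣m*n m)) (≡.cong (_+ o / n) (m*n/n≡m m n))

[m*n+o]/n≡m : ∀ m {n} .{{_ : NonZero n}} {o} → o < n → (m * n + o) / n ≡ m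
[m*n+o]/n≡m m {n} {o} o<n =
  ≡.trans ([m*n+o]/n≡m+o/n m n o) (≡.trans (≡.cong (m +_) (m<n⇒m/n≡0 o<n)) (ℕ.+-identityʳ m))

[m*n+o]%n≡o : ∀ m {n} .{{_ : NonZero n}} {o} → o < n → (m * n + o) % n ≡ o
[m*n+o]%n≡o m {n} {o} o<n =
  ≡.trans (≡.cong (_% n) (ℕ.+-comm (m * n) o)) (≡.trans ([m+kn]%n≡m%n o m n) (m<n⇒m%n≡m o<n))

data Block (s : ℕ) : ℕ → Set where
  block : ∀ q {r} → r < s → Block s (q * s + r)

toBlock : ∀ {s} .{{_ : NonZero s}} n → Block s n
toBlock {s} n = ≡.subst (Block s) n≡ (block (n / s) (m%n<n n s))
  where
  n≡ : n / s * s + n % s ≡ n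
  n≡ = ≡.trans (ℕ.+-comm (n / s * s) (n % s)) (≡.sym (m≡m%n+[m/n]*n n s))

block-index-< : ∀ {q r s b} → q * s + r < b * s → q < b
block-index-< {q} {r} {s} {b} lt = ℕ.*-cancelʳ-< s q b (ℕ.≤-<-trans (ℕ.m≤m+n (q * s) r) lt)

[q*b+d]*s+k≡q*[b*s]+[d*s+k] : ∀ q b d s k → (q * b + d) * s + k ≡ q * (b * s) + (d * s + k)
[q*b+d]*s+k≡q*[b*s]+[d*s+k] = solve-∀

m+[n+o]≡n+[m+o] : ∀ m n o → m + (n + o) ≡ n + (m + o)
m+[n+o]≡n+[m+o] = solve-∀

[1+q]*s+r≡q*s+r+s : ∀ q s r → suc q * s + r ≡ q * s + r + s
[1+q]*s+r≡q*s+r+s = solve-∀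

[1+q]*b≡1+[q*b+[b∸1]] : ∀ q b .{{_ : NonZero b}} → suc q * b + 0 ≡ suc (q * b + (b ∸ 1))
[1+q]*b≡1+[q*b+[b∸1]] q (suc b′) = [1+q]*[1+b′]≡1+[q*[1+b′]+b′] q b′
  where
  [1+q]*[1+b′]≡1+[q*[1+b′]+b′] : ∀ q b′ → suc q * suc b′ + 0 ≡ suc (q * suc b′ + b′)
  [1+q]*[1+b′]≡1+[q*[1+b′]+b′] = solve-∀

module _ (b : ℕ) .{{_ : NonZero b}} where
  open ≡

  n<b^n : 1 < b → ∀ n → n < b ^ n
  n<b^n 1<b zero    = s≤s z≤n
  n<b^n 1<b (suc n) = ℕ.≤-<-trans (n<b^n 1<b n) (ℕ.^-monoʳ-< b 1<b (ℕ.n<1+n n))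

  digit-< : ∀ j {n} → n < b ^ j → digit b j n ≡ 0
  digit-< j n<bʲ = trans (cong (_% b) (m<n⇒m/n≡0 {{ℕ.m^n≢0 b j}} n<bʲ)) (m<n⇒m%n≡m (>-nonZero⁻¹ b))

  digit-*-+ : ∀ m r {j N} → j < N → digit b j (m * b ^ N + r) ≡ digit b j r
  digit-*-+ m r {j} {N} j<N = begin
    (m * b ^ N + r) / b ^ j % b                 ≡⟨ cong (λ e → (m * e + r) / b ^ j % b) bᴺ≡bⁱ⁺¹*bʲ ⟩
    (m * (b ^ suc i * b ^ j) + r) / b ^ j % b   ≡⟨ cong (λ x → (x + r) / b ^ j % b) (ℕ.*-assoc m _ _) ⟨
    (m * b ^ suc i * b ^ j + r) / b ^ j % b     ≡⟨ cong (_% b) ([m*n+o]/n≡m+o/n (m * b ^ suc i) (b ^ j) r) ⟩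
    (m * b ^ suc i + r / b ^ j) % b             ≡⟨ %-remove-+ˡ (r / b ^ j) b∣m*bⁱ⁺¹ ⟩
    r / b ^ j % b                               ∎
    where
    open ≡-Reasoning
    instance _ = ℕ.m^n≢0 b j
    i : ℕ
    i = N ∸ suc j
    bᴺ≡bⁱ⁺¹*bʲ : b ^ N ≡ b ^ suc i * b ^ j
    bᴺ≡bⁱ⁺¹*bʲ = trans (cong (b ^_) (sym 1+i+j≡N)) (ℕ.^-distribˡ-+-* b (suc i) j)
      where
      1+i+j≡N : suc i + j ≡ N
      1+i+j≡N = trans (cong (_+ j) (sym (ℕ.+-∸-assoc 1 j<N))) (ℕ.m∸n+n≡m (ℕ.<⇒≤ j<N))
    b∣m*bⁱ⁺¹ : b ∣ m * b ^ suc i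
    b∣m*bⁱ⁺¹ = divides (m * b ^ i) (trans (cong (m *_) (ℕ.*-comm b (b ^ i))) (sym (ℕ.*-assoc m (b ^ i) b)))

  digit-*-+-top : ∀ N m {r} → r < b ^ N → digit b N (m * b ^ N + r) ≡ m % b
  digit-*-+-top N m r<bᴺ = cong (_% b) ([m*n+o]/n≡m m {{ℕ.m^n≢0 b N}} r<bᴺ)

  digitSumUpTo-*-+ : ∀ m r {k N} → k ≤ N → digitSumUpTo b k (m * b ^ N + r) ≡ digitSumUpTo b k r
  digitSumUpTo-*-+ m r {zero}  k≤N = refl
  digitSumUpTo-*-+ m r {suc k} k<N =
    cong₂ _+_ (digitSumUpTo-*-+ m r (ℕ.<⇒≤ k<N)) (digit-*-+ m r k<N)

  digitSumUpTo-block : ∀ N {d r} → d < b → r < b ^ N →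
                       digitSumUpTo b (suc N) (d * b ^ N + r) ≡ d + digitSumUpTo b N r
  digitSumUpTo-block N {d} {r} d<b r<bᴺ = trans
    (cong₂ _+_ (digitSumUpTo-*-+ d r {N} ℕ.≤-refl) (trans (digit-*-+-top N d r<bᴺ) (m<n⇒m%n≡m d<b)))
    (ℕ.+-comm (digitSumUpTo b N r) d)

  digitSumUpTo-stable : ∀ {K K′ n} → n < b ^ K → K ≤′ K′ → digitSumUpTo b K′ n ≡ digitSumUpTo b K n
  digitSumUpTo-stable n<bᴷ ≤′-refl = refl
  digitSumUpTo-stable {K′ = suc K′} n<bᴷ (≤′-step K≤′K′) =
    trans (cong₂ _+_ (digitSumUpTo-stable n<bᴷ K≤′K′)
                     (digit-< K′ (ℕ.<-≤-trans n<bᴷ (ℕ.^-monoʳ-≤ b (ℕ.≤′⇒≤ K≤′K′)))))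
          (ℕ.+-identityʳ _)

  digitSum≡digitSumUpTo : 2 ≤ b → ∀ {N n} → n < b ^ N → digitSum b n ≡ digitSumUpTo b N n
  digitSum≡digitSumUpTo 2≤b {N} {n} n<bᴺ with ℕ.≤-total N (suc n)
  ... | inj₁ N≤1+n = digitSumUpTo-stable n<bᴺ (ℕ.≤⇒≤′ N≤1+n)
  ... | inj₂ 1+n≤N = sym (digitSumUpTo-stable n<b^[1+n] (ℕ.≤⇒≤′ 1+n≤N))
    where
    n<b^[1+n] : n < b ^ suc n
    n<b^[1+n] = ℕ.<-≤-trans (n<b^n 2≤b n) (ℕ.^-monoʳ-≤ b (ℕ.n≤1+n n))

  digit≡b∸1⇒< : 2 ≤ b → ∀ {j N n} → n < b ^ N → digit b j n ≡ b ∸ 1 → j < N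
  digit≡b∸1⇒< 2≤b {j} {N} n<bᴺ digit≡b∸1 = ℕ.≰⇒> λ N≤j →
    ℕ.<⇒≢ (ℕ.∸-monoˡ-≤ 1 2≤b)
          (trans (sym (digit-< j (ℕ.<-≤-trans n<bᴺ (ℕ.^-monoʳ-≤ b N≤j)))) digit≡b∸1)

module _ {c ℓ : Level} (R : CommutativeRing c ℓ) where

  open CommutativeRing R hiding (zero) renaming (Carrier to C; _+_ to _⊕_; _*_ to _⊛_)
  open WithRing R
  open import Algebra.Properties.Ring ring
    using (-0#≈0#; -‿+-comm; +-cancelˡ; +-cancelʳ; x[y-z]≈xy-xz; [y-z]x≈yx-zx; xyx⁻¹≈y)
  open import Algebra.Properties.CommutativeSemigroup +-commutativeSemigroup using (interchange)
  open import Relation.Binary.Reasoning.Setoid setoid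

  x-0#≈x : ∀ x → x - 0# ≈ x
  x-0#≈x x = trans (+-congˡ -0#≈0#) (+-identityʳ x)

  sumTo-cong : ∀ n {f g : ℕ → C} → (∀ {k} → k < n → f k ≈ g k) → sumTo n f ≈ sumTo n g
  sumTo-cong zero    f≈g = refl
  sumTo-cong (suc n) f≈g = +-cong (sumTo-cong n (f≈g ∘ ℕ.m<n⇒m<1+n)) (f≈g (ℕ.n<1+n n))

  sumTo-zero : ∀ n {f : ℕ → C} → (∀ {k} → k < n → f k ≈ 0#) → sumTo n f ≈ 0#
  sumTo-zero zero    f≈0 = refl
  sumTo-zero (suc n) f≈0 =
    trans (+-cong (sumTo-zero n (f≈0 ∘ ℕ.m<n⇒m<1+n)) (f≈0 (ℕ.n<1+n n))) (+-identityʳ 0#)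

  sumTo-distrib-+ : ∀ n (f g : ℕ → C) → sumTo n (λ k → f k ⊕ g k) ≈ sumTo n f ⊕ sumTo n g
  sumTo-distrib-+ zero    f g = sym (+-identityʳ 0#)
  sumTo-distrib-+ (suc n) f g = trans (+-congʳ (sumTo-distrib-+ n f g)) (interchange _ _ _ _)

  sumTo-distrib-minus : ∀ n (f g : ℕ → C) → sumTo n (λ k → f k - g k) ≈ sumTo n f - sumTo n g
  sumTo-distrib-minus zero    f g = sym (x-0#≈x 0#)
  sumTo-distrib-minus (suc n) f g =
    trans (+-congʳ (sumTo-distrib-minus n f g)) (trans (interchange _ _ _ _) (+-congˡ (-‿+-comm _ _)))

  *-distribˡ-sumTo : ∀ n x (f : ℕ → C) → x ⊛ sumTo n f ≈ sumTo n (λ k → x ⊛ f k)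
  *-distribˡ-sumTo zero    x f = zeroʳ x
  *-distribˡ-sumTo (suc n) x f = trans (distribˡ x _ _) (+-congʳ (*-distribˡ-sumTo n x f))

  sumTo-+ : ∀ m k (f : ℕ → C) → sumTo (m + k) f ≈ sumTo m f ⊕ sumTo k (λ r → f (m + r))
  sumTo-+ m zero    f rewrite ℕ.+-identityʳ m = sym (+-identityʳ _)
  sumTo-+ m (suc k) f rewrite ℕ.+-suc m k = trans (+-congʳ (sumTo-+ m k f)) (+-assoc _ _ _)

  sumTo-suc : ∀ n (f : ℕ → C) → sumTo (suc n) f ≈ f 0 ⊕ sumTo n (f ∘ suc)
  sumTo-suc n f = trans (sumTo-+ 1 n f) (+-congʳ (+-identityˡ (f 0)))

  sumTo-* : ∀ m s (f : ℕ → C) → sumTo (m * s) f ≈ sumTo m (λ d → sumTo s (λ r → f (d * s + r)))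
  sumTo-* zero    s f = refl
  sumTo-* (suc m) s f rewrite ℕ.+-comm s (m * s) = trans (sumTo-+ (m * s) s f) (+-congʳ (sumTo-* m s f))

  sumTo-comm : ∀ m n (f : ℕ → ℕ → C) →
               sumTo m (λ i → sumTo n (f i)) ≈ sumTo n (λ j → sumTo m (λ i → f i j))
  sumTo-comm zero    n f = sym (sumTo-zero n (λ _ → refl))
  sumTo-comm (suc m) n f = trans (+-congʳ (sumTo-comm m n f)) (sym (sumTo-distrib-+ n _ (f m)))

  sumTo-single : ∀ n {i} (f : ℕ → C) → i < n → (∀ {k} → k < n → k ≢ i → f k ≈ 0#) → sumTo n f ≈ f i
  sumTo-single (suc n) {i} f i<1+n f≈0 with i ≟ n
  ... | yes ≡.refl =
    trans (+-congʳ (sumTo-zero n (λ k<n → f≈0 (ℕ.m<n⇒m<1+n k<n) (ℕ.<⇒≢ k<n)))) (+-identityˡ (f n))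
  ... | no  i≢n   =
    trans (+-cong (sumTo-single n f (ℕ.≤∧≢⇒< (ℕ.≤-pred i<1+n) i≢n) (f≈0 ∘ ℕ.m<n⇒m<1+n))
                  (f≈0 (ℕ.n<1+n n) (i≢n ∘ ≡.sym)))
          (+-identityʳ (f i))

  sumFin≈sumTo : ∀ n {h : Fin n → C} {f : ℕ → C} → (∀ k → h k ≈ f (toℕ k)) → sumFin n h ≈ sumTo n f
  sumFin≈sumTo zero    h≈f = refl
  sumFin≈sumTo (suc n) {f = f} h≈f =
    trans (+-cong (h≈f Fin.zero) (sumFin≈sumTo n (h≈f ∘ Fin.suc))) (sym (sumTo-suc n f))

  sumFin-cong : ∀ n {h h′ : Fin n → C} → (∀ k → h k ≈ h′ k) → sumFin n h ≈ sumFin n h′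
  sumFin-cong zero    h≈h′ = refl
  sumFin-cong (suc n) h≈h′ = +-cong (h≈h′ Fin.zero) (sumFin-cong n (h≈h′ ∘ Fin.suc))

  sumTo-rotate : ∀ n (f : ℕ → C) → f n ≈ f 0 → sumTo n (f ∘ suc) ≈ sumTo n f
  sumTo-rotate n f fn≈f0 = +-cancelˡ (f 0) _ _ (begin
    f 0 ⊕ sumTo n (f ∘ suc)  ≈⟨ sumTo-suc n f ⟨
    sumTo n f ⊕ f n          ≈⟨ +-congˡ fn≈f0 ⟩
    sumTo n f ⊕ f 0          ≈⟨ +-comm _ _ ⟩
    f 0 ⊕ sumTo n f          ∎)

  fromVec-< : ∀ m (v : Fin m → C) {n} (n<m : n < m) → fromVec m v n ≈ v (fromℕ< n<m)
  fromVec-< m v {n} n<m with n <? m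
  ... | yes _   = refl
  ... | no  n≮m = ⊥-elim (n≮m n<m)

  fromVec-≥ : ∀ m (v : Fin m → C) {n} → m ≤ n → fromVec m v n ≈ 0#
  fromVec-≥ m v {n} m≤n with n <? m
  ... | yes n<m = ⊥-elim (ℕ.<⇒≱ n<m m≤n)
  ... | no  _   = refl

  fromVec-toℕ : ∀ m (v : Fin m → C) k → fromVec m v (toℕ k) ≈ v k
  fromVec-toℕ m v k = trans (fromVec-< m v (toℕ<n k)) (reflexive (≡.cong v (fromℕ<-toℕ k (toℕ<n k))))

  fromVec-injective : ∀ m {v w : Fin m → C} → fromVec m v ≈ₚ fromVec m w → ∀ k → v k ≈ w k
  fromVec-injective m {v} {w} v≈w k = trans (sym (fromVec-toℕ m v k)) (trans (v≈w (toℕ k)) (fromVec-toℕ m w k))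

  xPow-refl : ∀ k → xPow k k ≈ 1#
  xPow-refl k with k ≟ k
  ... | yes _   = refl
  ... | no  k≢k = ⊥-elim (k≢k ≡.refl)

  xPow-≢ : ∀ {k n} → n ≢ k → xPow k n ≈ 0#
  xPow-≢ {k} {n} n≢k with n ≟ k
  ... | yes n≡k = ⊥-elim (n≢k n≡k)
  ... | no  _   = refl

  xPow-suc : ∀ k n → xPow (suc k) (suc n) ≈ xPow k n
  xPow-suc k n with n ≟ k
  ... | yes ≡.refl = xPow-refl (suc k)
  ... | no  n≢k    = xPow-≢ {suc k} (n≢k ∘ ℕ.suc-injective)

  sumTo-xPow : ∀ n (f : ℕ → C) {i} → i < n → sumTo n (λ k → xPow i k ⊛ f k) ≈ f i
  sumTo-xPow n f {i} i<n =
    trans (sumTo-single n _ i<n (λ _ k≢i → trans (*-congʳ (xPow-≢ k≢i)) (zeroˡ _)))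
          (trans (*-congʳ (xPow-refl i)) (*-identityˡ (f i)))

  ∇ : (ℕ → C) → ℕ → C
  ∇ X zero    = X zero
  ∇ X (suc e) = X (suc e) - X e

  ∇-cong : ∀ {X Y} d → (∀ {e} → e ≤ d → X e ≈ Y e) → ∇ X d ≈ ∇ Y d
  ∇-cong zero    X≈Y = X≈Y z≤n
  ∇-cong (suc e) X≈Y = +-cong (X≈Y ℕ.≤-refl) (-‿cong (X≈Y (ℕ.n≤1+n e)))

  ∇-partialSums : ∀ (f : ℕ → C) d → ∇ (λ e → sumTo (suc e) f) d ≈ f d
  ∇-partialSums f zero    = +-identityˡ (f 0)
  ∇-partialSums f (suc e) = xyx⁻¹≈y (sumTo (suc e) f) (f (suc e))

  M₁≈xPow-xPow : ∀ i j → M₁ i j ≈ xPow i j - xPow i (suc j)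
  M₁≈xPow-xPow i j with i ≟ j | i ≟ suc j
  ... | yes ≡.refl | _          =
    sym (trans (+-congˡ (-‿cong (xPow-≢ {i} ℕ.1+n≢n))) (trans (x-0#≈x _) (xPow-refl i)))
  ... | no  _      | yes ≡.refl =
    sym (trans (+-cong (xPow-≢ {suc j} (ℕ.1+n≢n ∘ ≡.sym)) (-‿cong (xPow-refl i))) (+-identityˡ _))
  ... | no  i≢j    | no  i≢1+j  =
    sym (trans (+-congˡ (-‿cong (xPow-≢ {i} (i≢1+j ∘ ≡.sym)))) (trans (x-0#≈x _) (xPow-≢ (i≢j ∘ ≡.sym))))

  M₁-row : ∀ m (X : ℕ → C) {d} → d < m → sumTo m (λ j → M₁ d j ⊛ X j) ≈ ∇ X d
  M₁-row m X {d} d<m = trans split (below d d<m)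
    where
    split : sumTo m (λ j → M₁ d j ⊛ X j)
              ≈ sumTo m (λ j → xPow d j ⊛ X j) - sumTo m (λ j → xPow d (suc j) ⊛ X j)
    split = trans (sumTo-cong m (λ {j} _ → trans (*-congʳ (M₁≈xPow-xPow d j)) ([y-z]x≈yx-zx (X j) _ _)))
                  (sumTo-distrib-minus m _ _)
    below : ∀ d → d < m → sumTo m (λ j → xPow d j ⊛ X j) - sumTo m (λ j → xPow d (suc j) ⊛ X j) ≈ ∇ X d
    below zero    0<m = trans (+-cong (sumTo-xPow m X 0<m) (-‿cong (sumTo-zero m 0≈))) (x-0#≈x (X 0))
      where
      0≈ : ∀ {j} → j < m → xPow 0 (suc j) ⊛ X j ≈ 0#
      0≈ {j} _ = trans (*-congʳ (xPow-≢ {0} {suc j} ℕ.1+n≢0)) (zeroˡ _)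
    below (suc e) e<m = +-cong (sumTo-xPow m X e<m)
                               (-‿cong (trans (sumTo-cong m (λ {j} _ → *-congʳ (xPow-suc e j)))
                                              (sumTo-xPow m X (ℕ.<-trans (ℕ.n<1+n e) e<m))))

  _-ₚ_ : Poly → Poly → Poly
  (p -ₚ q) n = p n - q n

  shift : ℕ → Poly → Poly
  shift K p j with K ≤? j
  ... | yes _ = p (j ∸ K)
  ... | no  _ = 0#

  shift-≥ : ∀ {K j} p → K ≤ j → shift K p j ≈ p (j ∸ K)
  shift-≥ {K} {j} p K≤j with K ≤? j
  ... | yes _   = refl
  ... | no  K≰j = ⊥-elim (K≰j K≤j)

  shift-< : ∀ {K j} p → j < K → shift K p j ≈ 0#
  shift-< {K} {j} p j<K with K ≤? j
  ... | yes K≤j = ⊥-elim (ℕ.<⇒≱ j<K K≤j)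
  ... | no  _   = refl

  shift-+ : ∀ K p n → shift K p (n + K) ≈ p n
  shift-+ K p n = trans (shift-≥ p (ℕ.m≤n+m K n)) (reflexive (≡.cong p (ℕ.m+n∸n≡m n K)))

  shift-cong : ∀ K {p q} → p ≈ₚ q → shift K p ≈ₚ shift K q
  shift-cong K p≈q j with K ≤? j
  ... | yes _ = p≈q (j ∸ K)
  ... | no  _ = refl

  *ₚ-congˡ : ∀ p {q r} → q ≈ₚ r → (p *ₚ q) ≈ₚ (p *ₚ r)
  *ₚ-congˡ p q≈r n = sumTo-cong (suc n) (λ {k} _ → *-congˡ (q≈r (n ∸ k)))

  *ₚ-distribˡ-ₚ : ∀ p q r → (p *ₚ (q -ₚ r)) ≈ₚ ((p *ₚ q) -ₚ (p *ₚ r))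
  *ₚ-distribˡ-ₚ p q r n =
    trans (sumTo-cong (suc n) (λ {k} _ → x[y-z]≈xy-xz (p k) (q (n ∸ k)) (r (n ∸ k)))) (sumTo-distrib-minus (suc n) _ _)

  *ₚ-identityʳ : ∀ p → (p *ₚ xPow 0) ≈ₚ p
  *ₚ-identityʳ p n = trans (sumTo-single (suc n) _ (ℕ.n<1+n n) off-diagonal) diagonal
    where
    off-diagonal : ∀ {k} → k < suc n → k ≢ n → p k ⊛ xPow 0 (n ∸ k) ≈ 0#
    off-diagonal k<1+n k≢n =
      trans (*-congˡ (xPow-≢ (k≢n ∘ ℕ.≤-antisym (ℕ.≤-pred k<1+n) ∘ ℕ.m∸n≡0⇒m≤n))) (zeroʳ _)
    diagonal : p n ⊛ xPow 0 (n ∸ n) ≈ p n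
    diagonal = trans (*-congˡ (reflexive (≡.cong (xPow 0) (ℕ.n∸n≡0 n)))) (*-identityʳ (p n))

  xPow≈shift : ∀ K → xPow K ≈ₚ shift K (xPow 0)
  xPow≈shift K j with K ≤? j
  ... | no  K≰j = xPow-≢ (K≰j ∘ ℕ.≤-reflexive ∘ ≡.sym)
  ... | yes K≤j with j ≟ K
  ...   | yes ≡.refl = reflexive (≡.sym (≡.cong (xPow 0) (ℕ.n∸n≡0 K)))
  ...   | no  j≢K    = sym (xPow-≢ (j≢K ∘ ≡.sym ∘ ℕ.≤-antisym K≤j ∘ ℕ.m∸n≡0⇒m≤n))

  *ₚ-shiftʳ-+ : ∀ p q K m → (p *ₚ shift K q) (m + K) ≈ (p *ₚ q) m
  *ₚ-shiftʳ-+ p q K m = begin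
    sumTo (suc m + K) g                                 ≈⟨ sumTo-+ (suc m) K g ⟩
    sumTo (suc m) g ⊕ sumTo K (λ r → g (suc m + r))     ≈⟨ +-cong (sumTo-cong (suc m) low) (sumTo-zero K high) ⟩
    (p *ₚ q) m ⊕ 0#                                     ≈⟨ +-identityʳ _ ⟩
    (p *ₚ q) m                                          ∎
    where
    g : ℕ → C
    g k = p k ⊛ shift K q (m + K ∸ k)
    low : ∀ {k} → k < suc m → g k ≈ p k ⊛ q (m ∸ k)
    low {k} k<1+m = *-congˡ (trans (reflexive (≡.cong (shift K q) (ℕ.+-∸-comm K (ℕ.≤-pred k<1+m))))
                                   (shift-+ K q (m ∸ k)))
    high : ∀ {r} → r < K → g (suc m + r) ≈ 0#
    high {r} r<K = trans (*-congˡ (shift-< q m+K∸[1+m+r]<K)) (zeroʳ _)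
      where
      m+K∸[1+m+r]<K : m + K ∸ (suc m + r) < K
      m+K∸[1+m+r]<K = ≡.subst (_< K)
        (≡.sym (≡.trans (≡.cong (m + K ∸_) (≡.sym (ℕ.+-suc m r))) (ℕ.[m+n]∸[m+o]≡n∸o m K (suc r))))
        (ℕ.∸-monoʳ-< (s≤s z≤n) r<K)

  *ₚ-shiftʳ-< : ∀ p q {K n} → n < K → (p *ₚ shift K q) n ≈ 0#
  *ₚ-shiftʳ-< p q {n = n} n<K =
    sumTo-zero (suc n) (λ {k} _ → trans (*-congˡ (shift-< q (ℕ.≤-<-trans (ℕ.m∸n≤m n k) n<K))) (zeroʳ _))

  *ₚ-shiftʳ : ∀ p q K → (p *ₚ shift K q) ≈ₚ shift K (p *ₚ q)
  *ₚ-shiftʳ p q K n with K ≤? n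
  ... | no  K≰n = *ₚ-shiftʳ-< p q (ℕ.≰⇒> K≰n)
  ... | yes K≤n = trans (reflexive (≡.cong (p *ₚ shift K q) (≡.sym (ℕ.m∸n+n≡m K≤n))))
                        (*ₚ-shiftʳ-+ p q K (n ∸ K))

  *ₚ-xPow : ∀ p K → (p *ₚ xPow K) ≈ₚ shift K p
  *ₚ-xPow p K n = begin
    (p *ₚ xPow K) n                ≈⟨ *ₚ-congˡ p (xPow≈shift K) n ⟩
    (p *ₚ shift K (xPow 0)) n      ≈⟨ *ₚ-shiftʳ p (xPow 0) K n ⟩
    shift K (p *ₚ xPow 0) n        ≈⟨ shift-cong K (*ₚ-identityʳ p) n ⟩
    shift K p n                    ∎

  *ₚ-oneMinusXPow : ∀ p K → (p *ₚ oneMinusXPow K) ≈ₚ (p -ₚ shift K p)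
  *ₚ-oneMinusXPow p K n =
    trans (*ₚ-distribˡ-ₚ p (xPow 0) (xPow K) n) (+-cong (*ₚ-identityʳ p n) (-‿cong (*ₚ-xPow p K n)))

  *ₚ-prodQ-suc : ∀ p b m → let T = p *ₚ prodQ b m in (p *ₚ prodQ b (suc m)) ≈ₚ (T -ₚ shift (b ^ m) T)
  *ₚ-prodQ-suc p b m n = begin
    (p *ₚ (Q *ₚ oneMinusXPow K)) n      ≈⟨ *ₚ-congˡ p (*ₚ-oneMinusXPow Q K) n ⟩
    (p *ₚ (Q -ₚ shift K Q)) n           ≈⟨ *ₚ-distribˡ-ₚ p Q (shift K Q) n ⟩
    (p *ₚ Q) n - (p *ₚ shift K Q) n     ≈⟨ +-congˡ (-‿cong (*ₚ-shiftʳ p Q K n)) ⟩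
    (p *ₚ Q) n - shift K (p *ₚ Q) n     ∎
    where
    Q : Poly
    Q = prodQ b m
    K : ℕ
    K = b ^ m

  -ₚ-shift-injective : ∀ K .{{_ : NonZero K}} {p q} → (p -ₚ shift K p) ≈ₚ (q -ₚ shift K q) → p ≈ₚ q
  -ₚ-shift-injective K {p} {q} eq = <-rec (λ n → p n ≈ q n) step
    where
    shift-agrees : ∀ n → (∀ {m} → m < n → p m ≈ q m) → shift K p n ≈ shift K q n
    shift-agrees n p≈q with K ≤? n
    ... | yes K≤n = p≈q (ℕ.∸-monoʳ-< (>-nonZero⁻¹ K) K≤n)
    ... | no  _   = refl
    step : ∀ n → (∀ {m} → m < n → p m ≈ q m) → p n ≈ q n
    step n p≈q = +-cancelʳ (- shift K p n) (p n) (q n)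
      (trans (eq n) (+-congˡ (-‿cong (sym (shift-agrees n p≈q)))))

  *ₚ-prodQ-injective : ∀ b .{{_ : NonZero b}} N {p q} → (p *ₚ prodQ b N) ≈ₚ (q *ₚ prodQ b N) → p ≈ₚ q
  *ₚ-prodQ-injective b zero    {p} {q} eq n = trans (sym (*ₚ-identityʳ p n)) (trans (eq n) (*ₚ-identityʳ q n))
  *ₚ-prodQ-injective b (suc N) {p} {q} eq = *ₚ-prodQ-injective b N
    (-ₚ-shift-injective (b ^ N) {{ℕ.m^n≢0 b N}}
      (λ n → trans (sym (*ₚ-prodQ-suc p b N n)) (trans (eq n) (*ₚ-prodQ-suc q b N n))))

  -ₚ-shift-block : ∀ g {s r} → r < s → ∀ Q → (g -ₚ shift s g) (Q * s + r) ≈ ∇ (λ Q′ → g (Q′ * s + r)) Q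
  -ₚ-shift-block g r<s zero = trans (+-congˡ (-‿cong (shift-< g r<s))) (x-0#≈x _)
  -ₚ-shift-block g {s} {r} r<s (suc Q) = +-congˡ (-‿cong (begin
    shift s g (suc Q * s + r)      ≡⟨ ≡.cong (shift s g) ([1+q]*s+r≡q*s+r+s Q s r) ⟩
    shift s g (Q * s + r + s)      ≈⟨ shift-+ s g (Q * s + r) ⟩
    g (Q * s + r)                  ∎))

  module _ (b : ℕ) .{{_ : NonZero b}} where

    ∇-block : ∀ {X : ℕ → C} → (∀ q → X (q * b + (b ∸ 1)) ≈ 0#) →
              ∀ q d → ∇ X (q * b + d) ≈ ∇ (λ d′ → X (q * b + d′)) d
    ∇-block X≈0 zero    zero = refl
    ∇-block {X} X≈0 (suc q) zero = begin
      ∇ X (suc q * b + 0)                         ≡⟨ ≡.cong (∇ X) ([1+q]*b≡1+[q*b+[b∸1]] q b) ⟩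
      X (suc m) - X m                             ≈⟨ +-congˡ (-‿cong (X≈0 q)) ⟩
      X (suc m) - 0#                              ≈⟨ x-0#≈x _ ⟩
      X (suc m)                                   ≡⟨ ≡.cong X ([1+q]*b≡1+[q*b+[b∸1]] q b) ⟨
      X (suc q * b + 0)                           ∎
      where
      m : ℕ
      m = q * b + (b ∸ 1)
    ∇-block {X} X≈0 q (suc e) = begin
      ∇ X (q * b + suc e)                         ≡⟨ ≡.cong (∇ X) (ℕ.+-suc (q * b) e) ⟩
      X (suc (q * b + e)) - X (q * b + e)         ≡⟨ ≡.cong (λ n → X n - X (q * b + e)) (ℕ.+-suc (q * b) e) ⟨
      X (q * b + suc e) - X (q * b + e)           ∎

    M-suc-block : ∀ N {d d′ r k} → r < b ^ N → k < b ^ N →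
                  M b (suc N) (d * b ^ N + r) (d′ * b ^ N + k) ≈ M₁ d d′ ⊛ M b N r k
    M-suc-block zero {d} {d′} (s≤s z≤n) (s≤s z≤n) =
      trans (reflexive (≡.cong₂ M₁ (ℕ.+-identityʳ (d * 1)) (ℕ.+-identityʳ (d′ * 1))))
            (trans (reflexive (≡.cong₂ M₁ (ℕ.*-identityʳ d) (ℕ.*-identityʳ d′)))
                   (sym (trans (*-congˡ (xPow-refl 0)) (*-identityʳ _))))
    M-suc-block (suc N) {d} {d′} r<s k<s = *-cong
      (reflexive (≡.cong₂ M₁ ([m*n+o]/n≡m d r<s) ([m*n+o]/n≡m d′ k<s)))
      (reflexive (≡.cong₂ (M b (suc N)) ([m*n+o]%n≡o d r<s) ([m*n+o]%n≡o d′ k<s)))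
      where instance _ = ℕ.m^n≢0 b (suc N)

    M-suc-row : ∀ N (g : ℕ → C) {d r} → d < b → r < b ^ N →
                sumTo (b ^ suc N) (λ K → M b (suc N) (d * b ^ N + r) K ⊛ g K)
                  ≈ ∇ (λ d′ → sumTo (b ^ N) (λ k → M b N r k ⊛ g (d′ * b ^ N + k))) d
    M-suc-row N g {d} {r} d<b r<s = begin
      sumTo (b * s) (λ K → M b (suc N) (d * s + r) K ⊛ g K)
        ≈⟨ sumTo-* b s _ ⟩
      sumTo b (λ d′ → sumTo s (λ k → M b (suc N) (d * s + r) (d′ * s + k) ⊛ g (d′ * s + k)))
        ≈⟨ sumTo-cong b (λ {d′} _ → trans (sumTo-cong s (factor d′)) (sym (*-distribˡ-sumTo s (M₁ d d′) _))) ⟩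
      sumTo b (λ d′ → M₁ d d′ ⊛ sumTo s (λ k → M b N r k ⊛ g (d′ * s + k)))
        ≈⟨ M₁-row b _ d<b ⟩
      ∇ (λ d′ → sumTo s (λ k → M b N r k ⊛ g (d′ * s + k))) d
        ∎
      where
      s : ℕ
      s = b ^ N
      factor : ∀ d′ {k} → k < s →
               M b (suc N) (d * s + r) (d′ * s + k) ⊛ g (d′ * s + k) ≈ M₁ d d′ ⊛ (M b N r k ⊛ g (d′ * s + k))
      factor d′ k<s = trans (*-congʳ (M-suc-block N {d} {d′} r<s k<s)) (*-assoc _ _ _)

    VanishesOnTopDigit : ℕ → Poly → Set ℓ
    VanishesOnTopDigit N c = ∀ n {j} → j < N → digit b j n ≡ b ∸ 1 → c n ≈ 0#

    *ₚ-prodQ-block : ∀ N {c} → VanishesOnTopDigit N c → ∀ q {r} → r < b ^ N →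
                     (c *ₚ prodQ b N) (q * b ^ N + r) ≈ sumTo (b ^ N) (λ k → M b N r k ⊛ c (q * b ^ N + k))
    *ₚ-prodQ-block zero {c} _ q (s≤s z≤n) =
      trans (*ₚ-identityʳ c _) (sym (trans (+-identityˡ _) (trans (*-congʳ (xPow-refl 0)) (*-identityˡ _))))
    *ₚ-prodQ-block (suc N) {c} free q {r} r<bs with toBlock {b ^ N} {{ℕ.m^n≢0 b N}} r
    ... | block d {r′} r′<s = begin
      T (suc N) (q * (b * s) + (d * s + r′))        ≡⟨ ≡.cong (T (suc N)) (regroup d r′) ⟨
      T (suc N) ((q * b + d) * s + r′)              ≈⟨ *ₚ-prodQ-suc c b N _ ⟩
      (T N -ₚ shift s (T N)) ((q * b + d) * s + r′) ≈⟨ -ₚ-shift-block (T N) r′<s (q * b + d) ⟩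
      ∇ Y (q * b + d)                               ≈⟨ ∇-block Y-last-digit q d ⟩
      ∇ (λ d′ → Y (q * b + d′)) d                   ≈⟨ ∇-cong d (λ {d′} _ → Y≈ (q * b + d′) d′ ≡.refl) ⟩
      ∇ (λ d′ → sumTo s (λ k → M b N r′ k ⊛ c (q * (b * s) + (d′ * s + k)))) d
                                                    ≈⟨ M-suc-row N (λ K → c (q * (b * s) + K)) {d} (block-index-< r<bs) r′<s ⟨
      sumTo (b * s) (λ K → M b (suc N) (d * s + r′) K ⊛ c (q * (b * s) + K)) ∎
      where
      s : ℕ
      s = b ^ N
      T : ℕ → Poly
      T n = c *ₚ prodQ b n
      Y : ℕ → C
      Y Q = T N (Q * s + r′)
      IH : ∀ Q → Y Q ≈ sumTo s (λ k → M b N r′ k ⊛ c (Q * s + k))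
      IH Q = *ₚ-prodQ-block N (λ n j<N → free n (ℕ.m<n⇒m<1+n j<N)) Q r′<s
      regroup : ∀ d′ k → (q * b + d′) * s + k ≡ q * (b * s) + (d′ * s + k)
      regroup d′ k = [q*b+d]*s+k≡q*[b*s]+[d*s+k] q b d′ s k
      Y≈ : ∀ Q d′ → Q ≡ q * b + d′ → Y Q ≈ sumTo s (λ k → M b N r′ k ⊛ c (q * (b * s) + (d′ * s + k)))
      Y≈ Q d′ ≡.refl = trans (IH Q) (sumTo-cong s (λ {k} _ → *-congˡ (reflexive (≡.cong c (regroup d′ k)))))
      Y-last-digit : ∀ q′ → Y (q′ * b + (b ∸ 1)) ≈ 0#
      Y-last-digit q′ = trans (IH (q′ * b + (b ∸ 1)))
        (sumTo-zero s (λ k<s → trans (*-congˡ (free _ (ℕ.n<1+n N) (last-digit k<s))) (zeroʳ _)))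
        where
        last-digit : ∀ {k} → k < s → digit b N ((q′ * b + (b ∸ 1)) * s + k) ≡ b ∸ 1
        last-digit k<s = ≡.trans (digit-*-+-top b N _ k<s)
                                 ([m*n+o]%n≡o q′ (ℕ.∸-monoʳ-< {o = 0} (s≤s z≤n) (>-nonZero⁻¹ b)))

    -- solution N A n = Σ_{e₀ ≤ n₀} ⋯ Σ_{e_{N-1} ≤ n_{N-1}} A (e₀ + ⋯ + e_{N-1}), where nⱼ = digit b j n.
    solution : ℕ → (ℕ → C) → ℕ → C
    solution zero    A n = A 0
    solution (suc N) A n = sumTo (suc (digit b N n)) (λ e → solution N (λ t → A (e + t)) n)

    solution-zero : ∀ N {A} → (∀ t → A t ≈ 0#) → ∀ n → solution N A n ≈ 0#
    solution-zero zero    A≈0 n = A≈0 0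
    solution-zero (suc N) A≈0 n = sumTo-zero (suc (digit b N n)) (λ {e} _ → solution-zero N (λ t → A≈0 (e + t)) n)

    sumTo-solution : ∀ N m (G : ℕ → ℕ → C) n →
                     sumTo m (λ i → solution N (G i) n) ≈ solution N (λ t → sumTo m (λ i → G i t)) n
    sumTo-solution zero    m G n = refl
    sumTo-solution (suc N) m G n = trans (sumTo-comm m (suc (digit b N n)) _)
      (sumTo-cong (suc (digit b N n)) (λ {e} _ → sumTo-solution N m (λ i t → G i (e + t)) n))

    solution-*-+ : ∀ N A m n → solution N A (m * b ^ N + n) ≈ solution N A n
    solution-*-+ zero    A m n = refl
    solution-*-+ (suc N) A m n = begin
      sumTo (suc (digit b N (m * (b * s) + n))) (λ e → solution N (A′ e) (m * (b * s) + n))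
        ≡⟨ ≡.cong₂ (λ u v → sumTo (suc u) (λ e → solution N (A′ e) v))
                   (digit-*-+ b m n (ℕ.n<1+n N)) (≡.cong (_+ n) (≡.sym (ℕ.*-assoc m b s))) ⟩
      sumTo (suc (digit b N n)) (λ e → solution N (A′ e) (m * b * s + n))
        ≈⟨ sumTo-cong (suc (digit b N n)) (λ {e} _ → solution-*-+ N (A′ e) (m * b) n) ⟩
      sumTo (suc (digit b N n)) (λ e → solution N (A′ e) n) ∎
      where
      s : ℕ
      s = b ^ N
      A′ : ℕ → ℕ → C
      A′ e t = A (e + t)

    WindowSumsVanish : (ℕ → C) → Set ℓ
    WindowSumsVanish A = ∀ t → sumTo b (λ d → A (d + t)) ≈ 0#

    solution-vanishesOnTopDigit : ∀ N {A} → WindowSumsVanish A → VanishesOnTopDigit N (solution N A)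
    solution-vanishesOnTopDigit (suc N) {A} windows n {j} j<1+N digit≡b∸1 with j ≟ N
    ... | yes ≡.refl = begin
      sumTo (suc (digit b N n)) (λ e → solution N (λ t → A (e + t)) n)
        ≡⟨ ≡.cong (λ u → sumTo u (λ e → solution N (λ t → A (e + t)) n))
                  (≡.trans (≡.cong suc digit≡b∸1) (ℕ.suc-pred b)) ⟩
      sumTo b (λ e → solution N (λ t → A (e + t)) n)  ≈⟨ sumTo-solution N b (λ e t → A (e + t)) n ⟩
      solution N (λ t → sumTo b (λ e → A (e + t))) n  ≈⟨ solution-zero N windows n ⟩
      0#                                              ∎
    ... | no  j≢N = sumTo-zero (suc (digit b N n)) (λ {e} _ →
            solution-vanishesOnTopDigit N (shifted-windows e) n (ℕ.≤∧≢⇒< (ℕ.≤-pred j<1+N) j≢N) digit≡b∸1)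
      where
      shifted-windows : ∀ e → WindowSumsVanish (λ t → A (e + t))
      shifted-windows e t =
        trans (sumTo-cong b (λ {d} _ → reflexive (≡.cong A (m+[n+o]≡n+[m+o] e d t)))) (windows (e + t))

    solution-matrix : ∀ N A {n} → n < b ^ N →
                      sumTo (b ^ N) (λ k → M b N n k ⊛ solution N A k) ≈ A (digitSumUpTo b N n)
    solution-matrix zero A (s≤s z≤n) = trans (+-identityˡ _) (trans (*-congʳ (xPow-refl 0)) (*-identityˡ _))
    solution-matrix (suc N) A {n} n<bs with toBlock {b ^ N} {{ℕ.m^n≢0 b N}} n
    ... | block d {r} r<s = begin
      sumTo (b * s) (λ K → M b (suc N) (d * s + r) K ⊛ solution (suc N) A K)
        ≈⟨ M-suc-row N (solution (suc N) A) d<b r<s ⟩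
      ∇ (λ d′ → sumTo s (λ k → M b N r k ⊛ solution (suc N) A (d′ * s + k))) d
        ≈⟨ ∇-cong d (λ d′≤d → column (ℕ.≤-<-trans d′≤d d<b)) ⟩
      ∇ (λ d′ → sumTo (suc d′) (λ e → A (e + x))) d
        ≈⟨ ∇-partialSums (λ e → A (e + x)) d ⟩
      A (d + x)
        ≡⟨ ≡.cong A (digitSumUpTo-block b N d<b r<s) ⟨
      A (digitSumUpTo b (suc N) (d * s + r)) ∎
      where
      s : ℕ
      s = b ^ N
      d<b : d < b
      d<b = block-index-< n<bs
      x : ℕ
      x = digitSumUpTo b N r
      A′ : ℕ → ℕ → C
      A′ e t = A (e + t)
      column : ∀ {d′} → d′ < b →
               sumTo s (λ k → M b N r k ⊛ solution (suc N) A (d′ * s + k)) ≈ sumTo (suc d′) (λ e → A (e + x))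
      column {d′} d′<b = begin
        sumTo s (λ k → M b N r k ⊛ solution (suc N) A (d′ * s + k))
          ≈⟨ sumTo-cong s (λ k<s → *-congˡ (unfold k<s)) ⟩
        sumTo s (λ k → M b N r k ⊛ sumTo (suc d′) (λ e → solution N (A′ e) k))
          ≈⟨ sumTo-cong s (λ {k} _ → *-distribˡ-sumTo (suc d′) (M b N r k) _) ⟩
        sumTo s (λ k → sumTo (suc d′) (λ e → M b N r k ⊛ solution N (A′ e) k))
          ≈⟨ sumTo-comm s (suc d′) _ ⟩
        sumTo (suc d′) (λ e → sumTo s (λ k → M b N r k ⊛ solution N (A′ e) k))
          ≈⟨ sumTo-cong (suc d′) (λ {e} _ → solution-matrix N (A′ e) r<s) ⟩
        sumTo (suc d′) (λ e → A (e + x)) ∎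
        where
        unfold : ∀ {k} → k < s → solution (suc N) A (d′ * s + k) ≈ sumTo (suc d′) (λ e → solution N (A′ e) k)
        unfold {k} k<s = trans
          (reflexive (≡.cong (λ u → sumTo (suc u) (λ e → solution N (A′ e) (d′ * s + k)))
                             (≡.trans (digit-*-+-top b N d′ k<s) (m<n⇒m%n≡m d′<b))))
          (sumTo-cong (suc d′) (λ {e} _ → solution-*-+ N (A′ e) d′ k))

    windowSums-periodic : ∀ {A : ℕ → C} → (∀ t → A (b + t) ≈ A t) →
                          ∀ t → sumTo b (λ d → A (d + t)) ≈ sumTo b A
    windowSums-periodic {A} periodic zero    = sumTo-cong b (λ {d} _ → reflexive (≡.cong A (ℕ.+-identityʳ d)))
    windowSums-periodic {A} periodic (suc t) = begin
      sumTo b (λ d → A (d + suc t))    ≈⟨ sumTo-cong b (λ {d} _ → reflexive (≡.cong A (ℕ.+-suc d t))) ⟩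
      sumTo b (λ d → A (suc d + t))    ≈⟨ sumTo-rotate b (λ d → A (d + t)) (periodic t) ⟩
      sumTo b (λ d → A (d + t))        ≈⟨ windowSums-periodic periodic t ⟩
      sumTo b A                        ∎

    -- a (u b n) is definitionally cyclic a (digitSum b n).
    cyclic : (Fin b → C) → ℕ → C
    cyclic a t = a (fromℕ< (m%n<n t b))

    cyclic-windowSums : ∀ {a} → ZeroSum b a → WindowSumsVanish (cyclic a)
    cyclic-windowSums {a} zeroSum t = begin
      sumTo b (λ d → cyclic a (d + t))  ≈⟨ windowSums-periodic periodic t ⟩
      sumTo b (cyclic a)                ≈⟨ sumFin≈sumTo b (λ k → reflexive (≡.sym (cyclic-toℕ k))) ⟨
      sumFin b a                        ≈⟨ zeroSum ⟩
      0#                                ∎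
      where
      periodic : ∀ t → cyclic a (b + t) ≈ cyclic a t
      periodic t = reflexive (≡.cong a (fromℕ<-cong _ _ (%-remove-+ˡ t (∣-refl {b})) _ _))
      cyclic-toℕ : ∀ k → cyclic a (toℕ k) ≡ a k
      cyclic-toℕ k =
        ≡.cong a (≡.trans (fromℕ<-cong _ _ (m<n⇒m%n≡m (toℕ<n k)) _ (toℕ<n k)) (fromℕ<-toℕ k (toℕ<n k)))

    matEq-cong : ∀ N {a cs cs′} → (∀ k → cs k ≈ cs′ k) → matEq b N a cs → matEq b N a cs′
    matEq-cong N cs≈cs′ eqs n = trans (eqs n) (sumFin-cong (b ^ N) (λ k → *-congˡ (cs≈cs′ k)))

    digitCond-cong : ∀ N {cs cs′} → (∀ k → cs k ≈ cs′ k) → digitCond b N cs → digitCond b N cs′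
    digitCond-cong N cs≈cs′ cond n hasDigit = trans (sym (cs≈cs′ n)) (cond n hasDigit)

    digitCond⇒VanishesOnTopDigit : ∀ N {cs} → digitCond b N cs → VanishesOnTopDigit N (P b N cs)
    digitCond⇒VanishesOnTopDigit N {cs} cond n {j} _ digit≡b∸1 with ℕ.<-≤-connex n (b ^ N)
    ... | inj₁ n<bᴺ = trans (fromVec-< (b ^ N) cs n<bᴺ)
                            (cond (fromℕ< n<bᴺ) (j , ≡.trans (≡.cong (digit b j) (toℕ-fromℕ< n<bᴺ)) digit≡b∸1))
    ... | inj₂ bᴺ≤n = fromVec-≥ (b ^ N) cs bᴺ≤n

    conditions⇒poly : ∀ N {a cs} → matEq b N a cs → digitCond b N cs → F b N a ≈ₚ (P b N cs *ₚ prodQ b N)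
    conditions⇒poly N {a} {cs} eqs cond n = coefficient (toBlock {s} {{ℕ.m^n≢0 b N}} n)
      where
      s : ℕ
      s = b ^ N
      T : Poly
      T = P b N cs *ₚ prodQ b N
      vanishes : VanishesOnTopDigit N (P b N cs)
      vanishes = digitCond⇒VanishesOnTopDigit N cond
      firstBlock : ∀ i → F b N a (toℕ i) ≈ T (toℕ i)
      firstBlock i = begin
        F b N a (toℕ i)                                ≈⟨ fromVec-toℕ s _ i ⟩
        a (u b (toℕ i))                                ≈⟨ eqs i ⟩
        sumFin s (λ k → M b N (toℕ i) (toℕ k) ⊛ cs k)  ≈⟨ sumFin≈sumTo s (λ k → *-congˡ (sym (fromVec-toℕ s cs k))) ⟩
        sumTo s (λ k → M b N (toℕ i) k ⊛ P b N cs k)   ≈⟨ *ₚ-prodQ-block N vanishes 0 (toℕ<n i) ⟨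
        T (toℕ i)                                      ∎
      coefficient : ∀ {n} → Block s n → F b N a n ≈ T n
      coefficient (block zero r<s) = ≡.subst (λ r → F b N a r ≈ T r) (toℕ-fromℕ< r<s) (firstBlock (fromℕ< r<s))
      coefficient (block (suc q) {r} r<s) = begin
        F b N a (suc q * s + r)                              ≈⟨ fromVec-≥ s _ beyond ⟩
        0#                                                   ≈⟨ sumTo-zero s (λ _ → trans (*-congˡ (fromVec-≥ s cs beyond)) (zeroʳ _)) ⟨
        sumTo s (λ k → M b N r k ⊛ P b N cs (suc q * s + k)) ≈⟨ *ₚ-prodQ-block N vanishes (suc q) r<s ⟨
        T (suc q * s + r)                                    ∎
        where
        beyond : ∀ {k} → s ≤ suc q * s + k
        beyond {k} = ℕ.≤-trans (ℕ.m≤m+n s (q * s)) (ℕ.m≤m+n (suc q * s) k)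

    solution-matEq : 2 ≤ b → ∀ N a → matEq b N a (λ k → solution N (cyclic a) (toℕ k))
    solution-matEq 2≤b N a n = begin
      cyclic a (digitSum b (toℕ n))
        ≡⟨ ≡.cong (cyclic a) (digitSum≡digitSumUpTo b 2≤b {N} (toℕ<n n)) ⟩
      cyclic a (digitSumUpTo b N (toℕ n))
        ≈⟨ solution-matrix N (cyclic a) (toℕ<n n) ⟨
      sumTo (b ^ N) (λ k → M b N (toℕ n) k ⊛ solution N (cyclic a) k)
        ≈⟨ sumFin≈sumTo (b ^ N) (λ _ → refl) ⟨
      sumFin (b ^ N) (λ k → M b N (toℕ n) (toℕ k) ⊛ solution N (cyclic a) (toℕ k))
        ∎

    solution-digitCond : 2 ≤ b → ∀ N {a} → ZeroSum b a → digitCond b N (λ k → solution N (cyclic a) (toℕ k))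
    solution-digitCond 2≤b N zeroSum n (j , digit≡b∸1) =
      solution-vanishesOnTopDigit N (cyclic-windowSums zeroSum) (toℕ n)
        (digit≡b∸1⇒< b 2≤b {j} (toℕ<n n) digit≡b∸1) digit≡b∸1

    poly⇒conditions : 2 ≤ b → ∀ N {a} → ZeroSum b a → ∀ {cs} →
                      F b N a ≈ₚ (P b N cs *ₚ prodQ b N) → matEq b N a cs × digitCond b N cs
    poly⇒conditions 2≤b N {a} zeroSum {cs} eq =
      matEq-cong N {a} solution≈cs solutionEq , digitCond-cong N solution≈cs solutionCond
      where
      solutionEq : matEq b N a (λ k → solution N (cyclic a) (toℕ k))
      solutionEq = solution-matEq 2≤b N a
      solutionCond : digitCond b N (λ k → solution N (cyclic a) (toℕ k))
      solutionCond = solution-digitCond 2≤b N zeroSum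
      solution≈cs : ∀ k → solution N (cyclic a) (toℕ k) ≈ cs k
      solution≈cs = fromVec-injective (b ^ N) (*ₚ-prodQ-injective b N
        (λ n → trans (sym (conditions⇒poly N {a} solutionEq solutionCond n)) (eq n)))

theorem3p2 : ∀ {c ℓ : Level} (R : CommutativeRing c ℓ) →
    let open WithRing R in
    (b : ℕ) .{{_ : NonZero b}} → 2 ≤ b → (N : ℕ) → 1 ≤ N →
    (a : Fin b → CommutativeRing.Carrier R) → ZeroSum b a →
    (cs : Fin (b ^ N) → CommutativeRing.Carrier R) →
    (F b N a ≈ₚ (P b N cs *ₚ prodQ b N))
    ⇔ (matEq b N a cs × digitCond b N cs)
theorem3p2 R b 2≤b N _ a zeroSum cs =
  mk⇔ (poly⇒conditions R b 2≤b N zeroSum) (uncurry (conditions⇒poly R b N {a}))
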